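{- For all $n\geq1$, $j_n(\{123,213\})=f_{n-1}$, where the Fibonacci numbers are defined by $f_0=f_1=1$ and $f_m=f_{m-1}+f_{m-2}$ for $m\geq2$.
   Context: A permutation of a finite set $S$ of positive integers is a word in which each element of $S$ appears exactly once; $\mathfrak{S}_n$ is the set of permutations of $\{1,\dots,n\}$. For a permutation $\pi$ and a letter $x$ of $\pi$, $\rho_\pi(x)$ is the maximal consecutive subword of $\pi$ consisting of the letters immediately to the right of $x$ that are all larger than $x$. $\pi$ is Jacobi if $|\rho_\pi(x)|$ is even for all letters $x$. A permutation $\pi$ avoids a pattern $\sigma$ if no subword of $\pi$ has standardization (relative order) $\sigma$. For a set $\Pi$ of patterns, $j_n(\Pi)$ is the number of Jacobi permutations in $\mathfrak{S}_n$ avoiding every pattern in $\Pi$. -}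

module Defs where

open import Data.Nat using (ℕ; zero; suc; _+_; _<ᵇ_; _≡ᵇ_)
open import Data.Bool using (Bool; true; false; _∧_; _∨_; not; if_then_else_)
open import Data.List using (List; []; _∷_; _++_; length; filter; map; concatMap)
open import Data.Bool.ListAction using (all; any; and)
open import Relation.Binary.PropositionalEquality using (_≡_)
open import Relation.Nullary using (¬_)
open import Relation.Nullary.Decidable using (yes; no)
open import Relation.Unary using (Pred; Decidable)
open import Data.Bool using (T)
open import Data.Unit using (⊤)

fib : ℕ → ℕ
fib zero = 1
fib (suc zero) = 1
fib (suc (suc m)) = fib (suc m) + fib m

insertions : ℕ → List ℕ → List (List ℕ)
insertions x [] = (x ∷ []) ∷ []
insertions x (y ∷ ys) = (x ∷ y ∷ ys) ∷ map (y ∷_) (insertions x ys)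

-- 𝔖 n : list of all permutations of {1,…,n} (words using each of 1..n once),
-- each exactly once
perms : ℕ → List (List ℕ)
perms zero = [] ∷ []
perms (suc n) = concatMap (insertions (suc n)) (perms n)

-- ρ_π(x) for the letter at the head of the suffix:
-- length of the maximal run right after x of letters larger than x
runLen : ℕ → List ℕ → ℕ
runLen x [] = 0
runLen x (y ∷ ys) = if x <ᵇ y then suc (runLen x ys) else 0

even : ℕ → Bool
even zero = true
even (suc zero) = false
even (suc (suc n)) = even n

isJacobi : List ℕ → Bool
isJacobi [] = true
isJacobi (x ∷ xs) = even (runLen x xs) ∧ isJacobi xs

subwords : ℕ → List ℕ → List (List ℕ)
subwords zero _ = [] ∷ []
subwords (suc k) [] = []
subwords (suc k) (x ∷ xs) = map (x ∷_) (subwords k xs) ++ subwords (suc k) xs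

-- two words of the same length have the same standardization (relative order)
-- iff for all positions i, j: w_i < w_j ⇔ v_i < v_j
sameOrder : List ℕ → List ℕ → Bool
sameOrder [] [] = true
sameOrder (a ∷ as) (b ∷ bs) =
  and (zipWithB a b as bs) ∧ sameOrder as bs
  where
  zipWithB : ℕ → ℕ → List ℕ → List ℕ → List Bool
  zipWithB a b [] [] = []
  zipWithB a b (c ∷ cs) (d ∷ ds) =
    ((a <ᵇ c) ≡ᵇB (b <ᵇ d)) ∷ (((c <ᵇ a) ≡ᵇB (d <ᵇ b)) ∷ zipWithB a b cs ds)
    where
    _≡ᵇB_ : Bool → Bool → Bool
    true ≡ᵇB true = true
    false ≡ᵇB false = true
    _ ≡ᵇB _ = false
  zipWithB a b _ _ = false ∷ []
sameOrder _ _ = false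

contains : List ℕ → List ℕ → Bool
contains π σ = any (sameOrder σ) (subwords (length σ) π)

avoidsAll : List (List ℕ) → List ℕ → Bool
avoidsAll Π π = all (λ σ → not (contains π σ)) Π

jCount : ℕ → List (List ℕ) → ℕ
jCount n Π = length (filter (λ π → T? (isJacobi π ∧ avoidsAll Π π)) (perms n))
  where
  T? : (b : Bool) → Relation.Nullary.Dec (T b)
  T? true = yes Data.Unit.tt
  T? false = no (λ ())

-- In a permutation avoiding 123 and 213 no letter has two smaller letters to its left, so the
-- largest letter n stands first or second. If it stands first it can be deleted: it begins no
-- occurrence of either pattern and its run is empty. If it stands second, π = y n ρ, then n - 1
-- must follow n directly: n - 1 = y would give y a run of length 1, and further right n - 1 would
-- have y and the first letter of ρ before it. Deleting the pair n (n - 1) shortens the run of y by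
-- two and destroys no occurrence, so j_n = j_(n-1) + j_(n-2). Since perms builds 𝔖_(n+1) by
-- inserting n + 1 into the words of 𝔖_n, both deletions are read backwards as insertions.
module Submission where

open import Defs
open import Data.Bool using (Bool; true; false; _∧_; _∨_; not; T)
open import Data.Bool.Properties using (∧-zeroʳ; ∨-zeroʳ; ∨-assoc; T-≡)
open import Data.Bool.ListAction using (any)
open import Data.List using (List; []; _∷_; _++_; length; map; filter; concatMap)
open import Data.List.Membership.Propositional using (_∈_)
open import Data.List.Membership.Propositional.Properties using (∈-map⁺; ∈-++⁺ˡ; ∈-++⁺ʳ)
open import Data.List.Properties using (map-++; map-cong-local)
open import Data.List.Relation.Binary.Sublist.Propositional using (_⊆_; []; _∷_; _∷ʳ_; from∈)
open import Data.List.Relation.Unary.All as All using (All; []; _∷_)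
open import Data.List.Relation.Unary.All.Properties using (map⁺; concat⁺)
open import Data.List.Relation.Unary.Any using (here; there)
open import Data.List.Relation.Unary.Unique.Propositional using (Unique; []; _∷_)
open import Data.Nat using (ℕ; zero; suc; _+_; _<_; _≤_; _<ᵇ_)
open import Data.Nat.ListAction using (sum)
open import Data.Nat.ListAction.Properties using (sum-++)
open import Data.Nat.Properties
  using (<⇒<ᵇ; <ᵇ-reflects-<; <⇒≱; <⇒≤; <-trans; <-cmp; <⇒≢; n<1+n; m<n⇒m<1+n; +-identityʳ;
         +-commutativeSemigroup)
open import Algebra.Properties.CommutativeSemigroup +-commutativeSemigroup using (interchange)
open import Data.Product using (_×_; _,_)
open import Function using (_∘_; Equivalence)
open import Relation.Binary using (tri<; tri≈; tri>)
open import Relation.Binary.PropositionalEquality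
  using (_≡_; _≢_; refl; sym; trans; cong; cong₂; module ≡-Reasoning)
open import Relation.Nullary using (Dec; yes; no; contradiction)
open import Relation.Nullary.Reflects using (ofʸ)

private variable
  A B : Set
  a b c m n x y M N : ℕ
  p s u ρ σ π : List ℕ
  xs ys : List A

pattern [_,_,_] a b c = a ∷ b ∷ c ∷ []

<⇒<ᵇ≡true : m < n → (m <ᵇ n) ≡ true
<⇒<ᵇ≡true = Equivalence.to T-≡ ∘ <⇒<ᵇ

≤⇒<ᵇ≡false : n ≤ m → (m <ᵇ n) ≡ false
≤⇒<ᵇ≡false {n} {m} n≤m with m <ᵇ n | <ᵇ-reflects-< m n
... | false | _       = refl
... | true  | ofʸ m<n = contradiction n≤m (<⇒≱ m<n)

𝟙 : Bool → ℕ
𝟙 true  = 1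
𝟙 false = 0

count : (A → Bool) → List A → ℕ
count p xs = sum (map (𝟙 ∘ p) xs)

length-filter≡count : (p : A → Bool) (P? : ∀ x → Dec (T (p x))) (xs : List A) →
                      length (filter P? xs) ≡ count p xs
length-filter≡count p P? []       = refl
length-filter≡count p P? (x ∷ xs) with p x | P? x
... | true  | yes _  = cong suc (length-filter≡count p P? xs)
... | true  | no ¬px = contradiction _ ¬px
... | false | no _   = length-filter≡count p P? xs

count-++ : (p : A → Bool) (xs ys : List A) → count p (xs ++ ys) ≡ count p xs + count p ys
count-++ p xs ys =
  trans (cong sum (map-++ (𝟙 ∘ p) xs ys)) (sum-++ (map (𝟙 ∘ p) xs) (map (𝟙 ∘ p) ys))

count-concatMap : (p : B → Bool) (f : A → List B) (xs : List A) →
                  count p (concatMap f xs) ≡ sum (map (count p ∘ f) xs)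
count-concatMap p f []       = refl
count-concatMap p f (x ∷ xs) =
  trans (count-++ p (f x) (concatMap f xs)) (cong (count p (f x) +_) (count-concatMap p f xs))

count-none : {p : A → Bool} → All (λ x → p x ≡ false) xs → count p xs ≡ 0
count-none []                    = refl
count-none (px ∷ pxs) rewrite px = count-none pxs

sum-map-+ : (f g : A → ℕ) (xs : List A) →
            sum (map (λ x → f x + g x) xs) ≡ sum (map f xs) + sum (map g xs)
sum-map-+ f g []       = refl
sum-map-+ f g (x ∷ xs) =
  trans (cong (f x + g x +_) (sum-map-+ f g xs)) (interchange (f x) (g x) _ _)

insertions-All : {P : ℕ → Set} → P x → All P ys → All (All P) (insertions x ys)
insertions-All px []         = (px ∷ []) ∷ []
insertions-All px (py ∷ pys) =
  (px ∷ py ∷ pys) ∷ map⁺ (All.map (py ∷_) (insertions-All px pys))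

insertions-∋ : ∀ x ys → All (x ∈_) (insertions x ys)
insertions-∋ x []       = here refl ∷ []
insertions-∋ x (y ∷ ys) = here refl ∷ map⁺ (All.map there (insertions-∋ x ys))

insertions-Unique : Unique (x ∷ ys) → All Unique (insertions x ys)
insertions-Unique {ys = []}     u = u ∷ []
insertions-Unique {ys = y ∷ ys} u@((x≢y ∷ x∉ys) ∷ y∉ys ∷ uys) =
  u ∷ map⁺ (All.zipWith (λ (y∉w , uw) → y∉w ∷ uw)
                        (insertions-All (x≢y ∘ sym) y∉ys , insertions-Unique (x∉ys ∷ uys)))

perms-bounded : ∀ n → All (All (_< suc n)) (perms n)
perms-bounded zero    = [] ∷ []
perms-bounded (suc n) = concat⁺ (map⁺ (All.map
  (insertions-All (n<1+n (suc n)) ∘ All.map m<n⇒m<1+n) (perms-bounded n)))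

perms-Unique : ∀ n → All Unique (perms n)
perms-Unique zero    = [] ∷ []
perms-Unique (suc n) = concat⁺ (map⁺ (All.zipWith
  (λ (σ<n , uσ) → insertions-Unique (All.map (λ y<n → <⇒≢ y<n ∘ sym) σ<n ∷ uσ))
  (perms-bounded n , perms-Unique n)))

perms-∋ : ∀ n → All (suc n ∈_) (perms (suc n))
perms-∋ n = concat⁺ (map⁺ (All.universal (insertions-∋ (suc n)) (perms n)))

perms-suc-invariant : ∀ n → All (λ σ → suc n ∈ σ × All (_< suc (suc n)) σ × Unique σ)
                                (perms (suc n))
perms-suc-invariant n =
  All.zip (perms-∋ n , All.zip (perms-bounded (suc n) , perms-Unique (suc n)))

⊆⇒∈-subwords : s ⊆ u → s ∈ subwords (length s) u
⊆⇒∈-subwords []                     = here refl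
⊆⇒∈-subwords {s = []}    (_ ∷ʳ _)   = here refl
⊆⇒∈-subwords {s = _ ∷ _} (y ∷ʳ s⊆u) = ∈-++⁺ʳ _ (⊆⇒∈-subwords s⊆u)
⊆⇒∈-subwords (refl ∷ s⊆u)           = ∈-++⁺ˡ (∈-map⁺ _ (⊆⇒∈-subwords s⊆u))

any-∈ : (f : A → Bool) {x : A} → x ∈ xs → f x ≡ true → any f xs ≡ true
any-∈ f (here refl) fx rewrite fx = refl
any-∈ {xs = x′ ∷ _} f (there x∈xs) fx rewrite any-∈ f x∈xs fx = ∨-zeroʳ (f x′)

any-++ : (f : A → Bool) (xs ys : List A) → any f (xs ++ ys) ≡ any f xs ∨ any f ys
any-++ f []       ys = refl
any-++ f (x ∷ xs) ys = trans (cong (f x ∨_) (any-++ f xs ys)) (sym (∨-assoc (f x) _ _))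

p123 p213 : List ℕ
p123 = [ 1 , 2 , 3 ]
p213 = [ 2 , 1 , 3 ]

record LastIsLargest (p : List ℕ) : Set where
  field
    first<last  : c ≤ a → sameOrder p [ a , b , c ] ≡ false
    second<last : c ≤ b → sameOrder p [ a , b , c ] ≡ false

open LastIsLargest

lastIsLargest-123 : LastIsLargest p123
lastIsLargest-123 .first<last {a = a} {b = b} c≤a
  rewrite ≤⇒<ᵇ≡false c≤a with a <ᵇ b | b <ᵇ a
... | true  | true  = refl
... | true  | false = refl
... | false | true  = refl
... | false | false = refl
lastIsLargest-123 .second<last c≤b rewrite ≤⇒<ᵇ≡false c≤b = ∧-zeroʳ _

lastIsLargest-213 : LastIsLargest p213
lastIsLargest-213 .first<last {a = a} {b = b} c≤a
  rewrite ≤⇒<ᵇ≡false c≤a with a <ᵇ b | b <ᵇ a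
... | true  | true  = refl
... | true  | false = refl
... | false | true  = refl
... | false | false = refl
lastIsLargest-213 .second<last c≤b rewrite ≤⇒<ᵇ≡false c≤b = ∧-zeroʳ _

sameOrder-123 : a < b → b < c → sameOrder p123 [ a , b , c ] ≡ true
sameOrder-123 a<b b<c
  rewrite <⇒<ᵇ≡true a<b | ≤⇒<ᵇ≡false (<⇒≤ a<b)
        | <⇒<ᵇ≡true (<-trans a<b b<c) | ≤⇒<ᵇ≡false (<⇒≤ (<-trans a<b b<c))
        | <⇒<ᵇ≡true b<c | ≤⇒<ᵇ≡false (<⇒≤ b<c) = refl

sameOrder-213 : b < a → a < c → sameOrder p213 [ a , b , c ] ≡ true
sameOrder-213 b<a a<c
  rewrite <⇒<ᵇ≡true b<a | ≤⇒<ᵇ≡false (<⇒≤ b<a)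
        | <⇒<ᵇ≡true a<c | ≤⇒<ᵇ≡false (<⇒≤ a<c)
        | <⇒<ᵇ≡true (<-trans b<a a<c) | ≤⇒<ᵇ≡false (<⇒≤ (<-trans b<a a<c)) = refl

occursAt : List ℕ → ℕ → List ℕ → Bool
occursAt p y u = any (sameOrder p) (map (y ∷_) (subwords 2 u))

contains-∷ : contains (y ∷ u) [ a , b , c ] ≡ occursAt [ a , b , c ] y u ∨ contains u [ a , b , c ]
contains-∷ {y} {u} {a} {b} {c} =
  any-++ (sameOrder [ a , b , c ]) (map (y ∷_) (subwords 2 u)) (subwords 3 u)

occursAt-∷ : ∀ p → occursAt p y (x ∷ u) ≡
             any (sameOrder p) (map (y ∷_) (map (x ∷_) (subwords 1 u))) ∨ occursAt p y u
occursAt-∷ {y} {x} {u} p = trans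
  (cong (any (sameOrder p)) (map-++ (y ∷_) (map (x ∷_) (subwords 1 u)) (subwords 2 u)))
  (any-++ (sameOrder p) (map (y ∷_) (map (x ∷_) (subwords 1 u))) (map (y ∷_) (subwords 2 u)))

any-sameOrder-triples : ∀ p → All (λ z → sameOrder p [ y , x , z ] ≡ false) u →
                        any (sameOrder p) (map (y ∷_) (map (x ∷_) (subwords 1 u))) ≡ false
any-sameOrder-triples p []                    = refl
any-sameOrder-triples p (pz ∷ pzs) rewrite pz = any-sameOrder-triples p pzs

occursAt-max : LastIsLargest p → All (_< N) u → occursAt p N u ≡ false
occursAt-max largest [] = refl
occursAt-max {p} {N} {x ∷ u} largest (_ ∷ u<N) = trans (occursAt-∷ {N} {x} {u} p)
  (cong₂ _∨_ (any-sameOrder-triples p (All.map (first<last largest ∘ <⇒≤) u<N))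
             (occursAt-max largest u<N))

occursAt-skip : LastIsLargest p → All (_< M) u → occursAt p y (M ∷ u) ≡ occursAt p y u
occursAt-skip {p} {M} {u} {y} largest u<M = trans (occursAt-∷ {y} {M} {u} p)
  (cong (_∨ occursAt p y u)
        (any-sameOrder-triples p (All.map (second<last largest ∘ <⇒≤) u<M)))

contains-∷-max : LastIsLargest [ a , b , c ] → All (_< N) u →
                 contains (N ∷ u) [ a , b , c ] ≡ contains u [ a , b , c ]
contains-∷-max {a} {b} {c} {N} {u} largest u<N =
  trans (contains-∷ {N} {u}) (cong (_∨ contains u [ a , b , c ]) (occursAt-max largest u<N))

contains-dropPair : LastIsLargest [ a , b , c ] → n < N → All (_< n) ρ →
                    contains (y ∷ N ∷ n ∷ ρ) [ a , b , c ] ≡ contains (y ∷ ρ) [ a , b , c ]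
contains-dropPair {a} {b} {c} {n} {N} {ρ} {y} largest n<N ρ<n = begin
  contains (y ∷ N ∷ n ∷ ρ) τ                         ≡⟨ contains-∷ {y} {N ∷ n ∷ ρ} ⟩
  occursAt τ y (N ∷ n ∷ ρ) ∨ contains (N ∷ n ∷ ρ) τ
    ≡⟨ cong₂ _∨_ (trans (occursAt-skip largest nρ<N) (occursAt-skip largest ρ<n))
                 (trans (contains-∷-max largest nρ<N) (contains-∷-max largest ρ<n)) ⟩
  occursAt τ y ρ ∨ contains ρ τ                      ≡⟨ contains-∷ {y} {ρ} ⟨
  contains (y ∷ ρ) τ                                 ∎
  where
  open ≡-Reasoning
  τ = [ a , b , c ]
  nρ<N = n<N ∷ All.map (λ z<n → <-trans z<n n<N) ρ<n

avoids : List ℕ → Bool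
avoids = avoidsAll (p123 ∷ p213 ∷ [])

good : List ℕ → Bool
good π = isJacobi π ∧ avoids π

avoids-cong : contains π p123 ≡ contains σ p123 → contains π p213 ≡ contains σ p213 →
              avoids π ≡ avoids σ
avoids-cong = cong₂ (λ c₁ c₂ → not c₁ ∧ (not c₂ ∧ true))

contains⇒good≡false : contains π p123 ∨ contains π p213 ≡ true → good π ≡ false
contains⇒good≡false {π} eq with contains π p123 | contains π p213
... | true  | _    = ∧-zeroʳ (isJacobi π)
... | false | true = ∧-zeroʳ (isJacobi π)

all<⇒runLen≡0 : All (_< x) u → runLen x u ≡ 0
all<⇒runLen≡0 []        = refl
all<⇒runLen≡0 (y<x ∷ _) rewrite ≤⇒<ᵇ≡false (<⇒≤ y<x) = refl

good-∷-max : All (_< N) σ → good (N ∷ σ) ≡ good σ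
good-∷-max {N} {σ} σ<N =
  cong₂ _∧_ (cong (λ r → even r ∧ isJacobi σ) (all<⇒runLen≡0 σ<N))
            (avoids-cong {N ∷ σ} {σ} (contains-∷-max lastIsLargest-123 σ<N)
                                     (contains-∷-max lastIsLargest-213 σ<N))

isJacobi-dropPair : y < n → n < N → All (_< n) ρ →
                    isJacobi (y ∷ N ∷ n ∷ ρ) ≡ isJacobi (y ∷ ρ)
isJacobi-dropPair y<n n<N ρ<n
  rewrite <⇒<ᵇ≡true (<-trans y<n n<N) | <⇒<ᵇ≡true y<n | ≤⇒<ᵇ≡false (<⇒≤ n<N)
        | all<⇒runLen≡0 ρ<n = refl

good-dropPair : y < n → n < N → All (_< n) ρ → good (y ∷ N ∷ n ∷ ρ) ≡ good (y ∷ ρ)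
good-dropPair {y} {n} {N} {ρ} y<n n<N ρ<n =
  cong₂ _∧_ (isJacobi-dropPair y<n n<N ρ<n)
            (avoids-cong {y ∷ N ∷ n ∷ ρ} {y ∷ ρ}
                         (contains-dropPair {y = y} lastIsLargest-123 n<N ρ<n)
                         (contains-dropPair {y = y} lastIsLargest-213 n<N ρ<n))

good-oddRun : y < n → n < N → ∀ ρ → good (n ∷ N ∷ y ∷ ρ) ≡ false
good-oddRun y<n n<N ρ rewrite <⇒<ᵇ≡true n<N | ≤⇒<ᵇ≡false (<⇒≤ y<n) = refl

twoSmallerBefore⇒good≡false : a ≢ b → a < c → b < c → [ a , b , c ] ⊆ π → good π ≡ false
twoSmallerBefore⇒good≡false {a} {b} {c} {π} a≢b a<c b<c abc⊆π with <-cmp a b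
... | tri< a<b _ _ = contains⇒good≡false {π} (cong (_∨ contains π p213)
  (any-∈ (sameOrder p123) (⊆⇒∈-subwords abc⊆π) (sameOrder-123 a<b b<c)))
... | tri≈ _ a≡b _ = contradiction a≡b a≢b
... | tri> _ _ b<a = contains⇒good≡false {π} (trans (cong (contains π p123 ∨_)
  (any-∈ (sameOrder p213) (⊆⇒∈-subwords abc⊆π) (sameOrder-213 b<a a<c)))
  (∨-zeroʳ (contains π p123)))

insertSecond : ℕ → List ℕ → List ℕ
insertSecond N []      = N ∷ []
insertSecond N (y ∷ ρ) = y ∷ N ∷ ρ

count-good-insertions : All (_< N) (y ∷ ρ) → Unique (y ∷ ρ) →
                        count good (insertions N (y ∷ ρ)) ≡ 𝟙 (good (y ∷ ρ)) + 𝟙 (good (y ∷ N ∷ ρ))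
count-good-insertions {ρ = []} σ<N _ = cong₂ _+_ (cong 𝟙 (good-∷-max σ<N)) (+-identityʳ _)
count-good-insertions {N} {y} {z ∷ zs} σ<N@(y<N ∷ z<N ∷ _) ((y≢z ∷ _) ∷ _) =
  cong₂ _+_ (cong 𝟙 (good-∷-max σ<N))
            (trans (cong (𝟙 (good (y ∷ N ∷ z ∷ zs)) +_) (count-none later-bad)) (+-identityʳ _))
  where
  later-bad : All (λ w → good w ≡ false) (map (y ∷_) (map (z ∷_) (insertions N zs)))
  later-bad = map⁺ (map⁺ (All.map
    (λ {w} N∈w → twoSmallerBefore⇒good≡false {π = y ∷ z ∷ w} y≢z y<N z<N
                   (refl ∷ refl ∷ from∈ N∈w))
    (insertions-∋ N zs)))

count-goodSecond-insertions : n < N → All (_< n) (y ∷ ρ) → Unique (y ∷ ρ) →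
                              count (good ∘ insertSecond N) (insertions n (y ∷ ρ)) ≡ 𝟙 (good (y ∷ ρ))
count-goodSecond-insertions {n} {N} {y} {[]} n<N (y<n ∷ []) _
  rewrite good-oddRun y<n n<N [] | good-dropPair y<n n<N [] = +-identityʳ _
count-goodSecond-insertions {n} {N} {y} {z ∷ zs} n<N (y<n ∷ ρ<n@(z<n ∷ _)) ((y≢z ∷ _) ∷ _)
  rewrite good-oddRun y<n n<N (z ∷ zs) | good-dropPair y<n n<N ρ<n =
  trans (cong (𝟙 (good (y ∷ z ∷ zs)) +_) (count-none later-bad)) (+-identityʳ _)
  where
  later-bad : All (λ w → good (insertSecond N w) ≡ false)
                  (map (y ∷_) (map (z ∷_) (insertions n zs)))
  later-bad = map⁺ (map⁺ (All.map
    (λ {w} n∈w → twoSmallerBefore⇒good≡false {π = y ∷ N ∷ z ∷ w} y≢z y<n z<n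
                   (refl ∷ N ∷ʳ refl ∷ from∈ n∈w))
    (insertions-∋ n zs)))

goodCount goodSecondCount : ℕ → ℕ
goodCount n       = count good (perms n)
goodSecondCount n = count (good ∘ insertSecond (suc n)) (perms n)

goodCount-suc : ∀ n → goodCount (suc (suc n)) ≡ goodCount (suc n) + goodSecondCount (suc n)
goodCount-suc n = begin
  count good (concatMap (insertions n+2) (perms (suc n)))
    ≡⟨ count-concatMap good (insertions n+2) (perms (suc n)) ⟩
  sum (map (count good ∘ insertions n+2) (perms (suc n)))
    ≡⟨ cong sum (map-cong-local (All.map split (perms-suc-invariant n))) ⟩
  sum (map (λ σ → 𝟙 (good σ) + 𝟙 (good (insertSecond n+2 σ))) (perms (suc n)))
    ≡⟨ sum-map-+ (𝟙 ∘ good) (𝟙 ∘ good ∘ insertSecond n+2) (perms (suc n)) ⟩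
  goodCount (suc n) + goodSecondCount (suc n) ∎
  where
  open ≡-Reasoning
  n+2 = suc (suc n)
  split : suc n ∈ σ × All (_< n+2) σ × Unique σ →
          count good (insertions n+2 σ) ≡ 𝟙 (good σ) + 𝟙 (good (insertSecond n+2 σ))
  split {_ ∷ _} (_ , σ<n+2 , uσ) = count-good-insertions σ<n+2 uσ

goodSecondCount-suc : ∀ n → goodSecondCount (suc (suc n)) ≡ goodCount (suc n)
goodSecondCount-suc n = begin
  count (good ∘ insertSecond n+3) (concatMap (insertions n+2) (perms (suc n)))
    ≡⟨ count-concatMap (good ∘ insertSecond n+3) (insertions n+2) (perms (suc n)) ⟩
  sum (map (count (good ∘ insertSecond n+3) ∘ insertions n+2) (perms (suc n)))
    ≡⟨ cong sum (map-cong-local (All.map split (perms-suc-invariant n))) ⟩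
  goodCount (suc n) ∎
  where
  open ≡-Reasoning
  n+2 = suc (suc n)
  n+3 = suc n+2
  split : suc n ∈ σ × All (_< n+2) σ × Unique σ →
          count (good ∘ insertSecond n+3) (insertions n+2 σ) ≡ 𝟙 (good σ)
  split {_ ∷ _} (_ , σ<n+2 , uσ) = count-goodSecond-insertions (n<1+n n+2) σ<n+2 uσ

goodCount≡fib : ∀ m → goodCount (suc m) ≡ fib m
goodCount≡fib zero          = refl
goodCount≡fib (suc zero)    = refl
goodCount≡fib (suc (suc m)) = begin
  goodCount (3 + m)                           ≡⟨ goodCount-suc (suc m) ⟩
  goodCount (2 + m) + goodSecondCount (2 + m) ≡⟨ cong (goodCount (2 + m) +_) (goodSecondCount-suc m) ⟩
  goodCount (2 + m) + goodCount (1 + m)       ≡⟨ cong₂ _+_ (goodCount≡fib (suc m)) (goodCount≡fib m) ⟩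
  fib (suc m) + fib m                         ∎
  where open ≡-Reasoning

theorem8p4 : (m : ℕ) → jCount (suc m) ((1 ∷ 2 ∷ 3 ∷ []) ∷ (2 ∷ 1 ∷ 3 ∷ []) ∷ []) ≡ fib m
theorem8p4 m = trans (length-filter≡count good _ (perms (suc m))) (goodCount≡fib m)
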